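{- Let $G=\mathbb{Z}_n$, $2\le k\le n-1$, and $x_1,x_2\in G$. If $\gcd(x_1,n)=\gcd(x_2,n)$, then $(G,\mathcal{B}_k^{x_1})$ and $(G,\mathcal{B}_k^{x_2})$ are either both $1$-designs or neither is a $1$-design.
   Context: $\mathcal{B}_k^x$ is the family of all $k$-subsets of $\mathbb{Z}_n$ whose elements sum to $x$; $(G,\mathcal{B}_k^x)$ is a $1$-design if every element of $G$ lies in the same number of these subsets. Elements of $\mathbb{Z}_n$ are identified with integer representatives for computing $\gcd$. -}

module Defs where

open import Data.Nat using (ℕ; zero; suc; _+_; _^_; _≡ᵇ_; _%_)
open import Data.Bool using (Bool; true; false; _∧_)
open import Data.Fin using (Fin; toℕ)
open import Data.Fin.Subset using (Subset; ∣_∣)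
open import Data.Vec using (Vec; []; _∷_; tabulate; sum; lookup)
import Data.List as L
open import Relation.Binary.PropositionalEquality using (_≡_)

allSubsets : (n : ℕ) → L.List (Subset n)
allSubsets zero    = L.[ [] ]
allSubsets (suc n) = L.map (false ∷_) (allSubsets n) L.++ L.map (true ∷_) (allSubsets n)

memVal : Bool → ℕ → ℕ
memVal true  v = v
memVal false _ = 0

elemSum : {n : ℕ} → Subset n → ℕ
elemSum {n} S = sum (tabulate λ (i : Fin n) → memVal (lookup S i) (toℕ i))

sumsTo : (n : ℕ) → Subset n → Fin n → Bool
sumsTo zero    S ()
sumsTo (suc m) S x = (elemSum S % suc m) ≡ᵇ toℕ x

inB : (n k : ℕ) → Fin n → Subset n → Bool
inB n k x S = (∣ S ∣ ≡ᵇ k) ∧ sumsTo n S x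

replication : (n k : ℕ) → Fin n → Fin n → ℕ
replication n k x g = L.length (L.filterᵇ (λ S → inB n k x S ∧ lookup S g) (allSubsets n))

Is1Design : (n k : ℕ) → Fin n → Set
Is1Design n k x = ∀ (g h : Fin n) → replication n k x g ≡ replication n k x h

-- Write d = gcd x₁ n = gcd x₂ n. Each xᵢ / d is coprime to n / d and so lifts to a unit Uᵢ of ℤ_n
-- with Uᵢ d ≡ xᵢ; hence x₂ ≡ u x₁ for the unit u = U₂ U₁⁻¹. Multiplication by u permutes ℤ_n,
-- preserves the size of a subset and multiplies its element sum by u, so it maps the blocks of
-- 𝓑_k^{x₁} through g bijectively onto the blocks of 𝓑_k^{x₂} through u g. The replication numbers
-- of the two families thus differ by a permutation of ℤ_n, and one is constant iff the other is.
{-# OPTIONS --safe #-}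
module Submission where

open import Defs
open import Data.Nat
open import Data.Nat.Properties
open import Data.Nat.DivMod
open import Data.Nat.Divisibility
open import Data.Nat.GCD
open import Data.Nat.Coprimality using (Coprime; coprime-divisor; coprime-Bézout; gcd≡1⇒coprime; coprime-/gcd)
open import Data.Nat.Induction using (<-rec)
open import Data.Nat.Tactic.RingSolver using (solve-∀)
open import Data.Bool.Base using (Bool; true; false; _∧_; T)
open import Data.Empty using (⊥)
open import Data.Product using (∃; ∃₂; _×_; _,_)
open import Data.Sum using (inj₂)
open import Data.Fin.Base using (Fin; toℕ; fromℕ<)
open import Data.Fin.Properties using (toℕ-fromℕ<; toℕ-injective; toℕ<n)
open import Data.Fin.Subset using (Subset; ∣_∣)
open import Data.Fin.Permutation as Permutation using (Permutation′; permutation; _⟨$⟩ʳ_; _⟨$⟩ˡ_)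
open import Data.Vec.Base as Vec using ([]; _∷_; tabulate; lookup)
open import Data.Vec.Properties using (lookup∘tabulate; tabulate∘lookup; tabulate-cong; ∷-injectiveʳ)
open import Data.List.Base as List using (List; length; map; filterᵇ)
open import Data.List.Properties using (filter-≐)
open import Data.List.Membership.Propositional using (_∈_)
open import Data.List.Membership.Propositional.Properties using (∈-map⁺; ∈-map⁻; ∈-++⁺ˡ; ∈-++⁺ʳ)
open import Data.List.Membership.Propositional.Properties.WithK using (unique∧set⇒bag)
open import Data.List.Relation.Unary.Any using (here)
import Data.List.Relation.Unary.All as All
open import Data.List.Relation.Unary.AllPairs using ([]; _∷_)
open import Data.List.Relation.Unary.Unique.Propositional using (Unique)
import Data.List.Relation.Unary.Unique.Propositional.Properties as Unique
open import Data.List.Relation.Binary.BagAndSetEquality using (∼bag⇒↭)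
open import Data.List.Relation.Binary.Permutation.Propositional using (_↭_)
open import Data.List.Relation.Binary.Permutation.Propositional.Properties using (filter-↭; ↭-length)
open import Algebra.Properties.CommutativeMonoid.Sum +-0-commutativeMonoid using (sum; sum-permute; sum-cong-≗)
open import Function.Base using (_∘_; it)
open import Function.Bundles using (_↔_; _⇔_; mk⇔; mk↔ₛ′; Inverse)
open import Level using (0ℓ)
open import Relation.Nullary using (Dec; does; contradiction)
open import Relation.Nullary.Decidable using (T?; does-⇔; map′)
open import Relation.Binary.Bundles using (Setoid)
open import Relation.Binary.Structures using (IsEquivalence)
open import Relation.Binary.PropositionalEquality
import Relation.Binary.Reasoning.Setoid as ≈-Reasoning

variable
  a b c d m n o : ℕ

coprime-∣ˡ : d ∣ m → Coprime m n → Coprime d n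
coprime-∣ˡ d∣m m⊥n (i∣d , i∣n) = m⊥n (∣-trans i∣d d∣m , i∣n)

coprime-∣ʳ : d ∣ n → Coprime m n → Coprime m d
coprime-∣ʳ d∣n m⊥n (i∣m , i∣d) = m⊥n (i∣m , ∣-trans i∣d d∣n)

coprime-*ʳ : Coprime m n → Coprime m o → Coprime m (n * o)
coprime-*ʳ m⊥n m⊥o (i∣m , i∣no) = m⊥o (i∣m , coprime-divisor (coprime-∣ˡ i∣m m⊥n) i∣no)

coprime-^ʳ : ∀ k → Coprime m n → Coprime m (n ^ k)
coprime-^ʳ zero    m⊥n (_ , i∣1) = ∣1⇒≡1 i∣1
coprime-^ʳ (suc k) m⊥n = coprime-*ʳ m⊥n (coprime-^ʳ k m⊥n)

CoprimePart : ℕ → ℕ → Set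
CoprimePart w n = ∃₂ λ r N → Coprime r w × n ∣ r * w ^ N

coprimePart : ∀ w n .{{_ : NonZero n}} → CoprimePart w n
coprimePart w = <-rec P step
  where
  P : ℕ → Set
  P n = .{{_ : NonZero n}} → CoprimePart w n
  step : ∀ n → (∀ {m} → m < n → P m) → P n
  step n rec with gcd n w in g≡ | gcd[m,n]∣m n w | gcd[m,n]∣n n w
  ... | 0 | divides q n≡q*0 | _ = contradiction (trans n≡q*0 (*-zeroʳ q)) (≢-nonZero⁻¹ n)
  ... | 1 | _ | _ = n , 0 , gcd≡1⇒coprime g≡ , ∣-reflexive (sym (*-identityʳ n))
  ... | g@(2+ _) | divides q n≡q*g | g∣w = extend (rec q<n)
    where
    instance
      q≢0 : NonZero q
      q≢0 = m*n≢0⇒m≢0 q {{subst NonZero n≡q*g it}}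
    q<n : q < n
    q<n = subst (q <_) (sym n≡q*g) (m<m*n q g (s≤s (s≤s z≤n)))
    extend : CoprimePart w q → CoprimePart w n
    extend (r , N , r⊥w , q∣rw^N) = r , suc N , r⊥w , n∣rw^[1+N]
      where
      n∣rw^[1+N] : n ∣ r * w ^ suc N
      n∣rw^[1+N] = subst₂ _∣_ (sym n≡q*g) (trans (*-assoc r (w ^ N) w) (cong (r *_) (*-comm (w ^ N) w)))
                            (*-pres-∣ q∣rw^N g∣w)

-- Take r ⊥ a with n ∣ r aᴺ: then a + m r is coprime to r and, since a ⊥ m, to a.
coprime-shift : ∀ n .{{_ : NonZero n}} → Coprime a m → ∃ λ t → Coprime (a + m * t) n
coprime-shift {a} {m} n a⊥m with coprimePart a n
... | r , N , r⊥a , n∣ra^N = r , coprime-∣ʳ n∣ra^N (coprime-*ʳ u⊥r (coprime-^ʳ N u⊥a))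
  where
  u⊥r : Coprime (a + m * r) r
  u⊥r {i} (i∣u , i∣r) =
    r⊥a (i∣r , ∣m+n∣m⇒∣n (subst (i ∣_) (+-comm a (m * r)) i∣u) (∣n⇒∣m*n m i∣r))
  u⊥a : Coprime (a + m * r) a
  u⊥a (i∣u , i∣a) = r⊥a (coprime-divisor (coprime-∣ˡ i∣a a⊥m) (∣m+n∣m⇒∣n i∣u i∣a) , i∣a)

module Modulo (n : ℕ) .{{_ : NonZero n}} where

  -- A record rather than an abbreviation for a % n ≡ b % n, so that a and b can be
  -- inferred from a proof of a ≈ b.
  infix 4 _≈_
  record _≈_ (a b : ℕ) : Set where
    constructor mk≈
    field %-≡ : a % n ≡ b % n
  open _≈_ public

  ≈-isEquivalence : IsEquivalence _≈_
  ≈-isEquivalence = record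
    { refl  = mk≈ refl
    ; sym   = λ (mk≈ a≡b) → mk≈ (sym a≡b)
    ; trans = λ (mk≈ a≡b) (mk≈ b≡c) → mk≈ (trans a≡b b≡c)
    }

  ≈-setoid : Setoid 0ℓ 0ℓ
  ≈-setoid = record { isEquivalence = ≈-isEquivalence }

  open IsEquivalence ≈-isEquivalence public
    using () renaming (refl to ≈-refl; sym to ≈-sym; trans to ≈-trans; reflexive to ≈-reflexive)

  _≈?_ : ∀ a b → Dec (a ≈ b)
  a ≈? b = map′ mk≈ %-≡ (a % n ≟ b % n)

  m%n≈m : ∀ a → a % n ≈ a
  m%n≈m a = mk≈ (m%n%n≡m%n a n)

  m+kn≈m : ∀ a k → a + k * n ≈ a
  m+kn≈m a k = mk≈ ([m+kn]%n≡m%n a k n)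

  +-cong : a ≈ b → c ≈ d → a + c ≈ b + d
  +-cong {a} {b} {c} {d} (mk≈ a≡b) (mk≈ c≡d) = mk≈ (begin
    (a + c) % n                 ≡⟨ %-distribˡ-+ a c n ⟩
    (a % n + c % n) % n         ≡⟨ cong₂ (λ x y → (x + y) % n) a≡b c≡d ⟩
    (b % n + d % n) % n         ≡⟨ %-distribˡ-+ b d n ⟨
    (b + d) % n                 ∎)
    where open ≡-Reasoning

  *-cong : a ≈ b → c ≈ d → a * c ≈ b * d
  *-cong {a} {b} {c} {d} (mk≈ a≡b) (mk≈ c≡d) = mk≈ (begin
    (a * c) % n                 ≡⟨ %-distribˡ-* a c n ⟩
    (a % n * (c % n)) % n       ≡⟨ cong₂ (λ x y → (x * y) % n) a≡b c≡d ⟩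
    (b % n * (d % n)) % n       ≡⟨ %-distribˡ-* b d n ⟨
    (b * d) % n                 ∎)
    where open ≡-Reasoning

  *-congˡ : ∀ a → b ≈ c → a * b ≈ a * c
  *-congˡ a = *-cong (≈-refl {a})

  open ≈-Reasoning ≈-setoid

  coprime⇒invertible : Coprime a n → ∃ λ b → b * a ≈ 1
  coprime⇒invertible {a} a⊥n with coprime-Bézout a⊥n
  ... | Bézout.+- x y 1+yn≡xa = x , ≈-trans (≈-reflexive (sym 1+yn≡xa)) (m+kn≈m 1 y)
  -- Here x a ≡ -1, so (n - 1) x inverts a.
  ... | Bézout.-+ x y 1+xa≡yn = pred n * x , (begin
    pred n * x * a                 ≈⟨ m+kn≈m _ y ⟨
    pred n * x * a + y * n         ≡⟨ cong (pred n * x * a +_) 1+xa≡yn ⟨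
    pred n * x * a + (1 + x * a)   ≡⟨ regroup (pred n) x a ⟩
    1 + x * a * suc (pred n)       ≡⟨ cong (λ m → 1 + x * a * m) (suc-pred n) ⟩
    1 + x * a * n                  ≈⟨ m+kn≈m 1 (x * a) ⟩
    1                              ∎)
    where
    regroup : ∀ p x a → p * x * a + (1 + x * a) ≡ 1 + x * a * suc p
    regroup = solve-∀

  unit*gcd≈ : ∀ x → ∃ λ u → Coprime u n × u * gcd x n ≈ x
  unit*gcd≈ x = let t , u⊥n = coprime-shift n (coprime-/gcd x n) in _ , u⊥n , u*g≈x t
    where
    g = gcd x n
    instance
      g≢0 : NonZero g
      g≢0 = ≢-nonZero (gcd[m,n]≢0 x n (inj₂ (≢-nonZero⁻¹ n)))
    regroup : ∀ a m t e → (a + m * t) * e ≡ a * e + t * (m * e)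
    regroup = solve-∀
    u*g≈x : ∀ t → (x / g + n / g * t) * g ≈ x
    u*g≈x t = begin
      (x / g + n / g * t) * g         ≡⟨ regroup (x / g) (n / g) t g ⟩
      x / g * g + t * (n / g * g)     ≡⟨ cong₂ (λ y z → y + t * z) (m/n*n≡m (gcd[m,n]∣m x n))
                                                                   (m/n*n≡m (gcd[m,n]∣n x n)) ⟩
      x + t * n                       ≈⟨ m+kn≈m x t ⟩
      x                               ∎

  unit-cancelˡ : ∀ u v a → v * u ≈ 1 → v * (u * a) ≈ a
  unit-cancelˡ u v a v*u≈1 = begin
    v * (u * a)   ≡⟨ *-assoc v u a ⟨
    v * u * a     ≈⟨ *-cong v*u≈1 ≈-refl ⟩
    1 * a         ≡⟨ *-identityˡ a ⟩
    a             ∎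

  unit-*-injective : ∀ u v → v * u ≈ 1 → u * a ≈ u * b → a ≈ b
  unit-*-injective {a} {b} u v v*u≈1 ua≈ub = begin
    a             ≈⟨ unit-cancelˡ u v a v*u≈1 ⟨
    v * (u * a)   ≈⟨ *-congˡ v ua≈ub ⟩
    v * (u * b)   ≈⟨ unit-cancelˡ u v b v*u≈1 ⟩
    b             ∎

  rescale-inverse : ∀ u v w w′ → v * u ≈ 1 → w′ * w ≈ 1 → u * w′ * (w * v) ≈ 1
  rescale-inverse u v w w′ v*u≈1 w′*w≈1 = begin
    u * w′ * (w * v)   ≡⟨ regroup u w′ w v ⟩
    v * u * (w′ * w)   ≈⟨ *-cong v*u≈1 w′*w≈1 ⟩
    1                  ∎
    where
    regroup : ∀ a b c d → a * b * (c * d) ≡ d * a * (b * c)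
    regroup = solve-∀

  rescale : ∀ u v w g → v * u ≈ 1 → u * g ≈ a → w * g ≈ b → w * v * a ≈ b
  rescale {a} {b} u v w g v*u≈1 u*g≈a w*g≈b = begin
    w * v * a           ≈⟨ *-congˡ (w * v) u*g≈a ⟨
    w * v * (u * g)     ≡⟨ *-assoc w v (u * g) ⟩
    w * (v * (u * g))   ≈⟨ *-congˡ w (unit-cancelˡ u v g v*u≈1) ⟩
    w * g               ≈⟨ w*g≈b ⟩
    b                   ∎

  gcd≡⇒unit-multiple : ∀ {x y} → gcd x n ≡ gcd y n → ∃₂ λ u v → v * u ≈ 1 × u * x ≈ y
  gcd≡⇒unit-multiple {x} {y} gcd≡ =
    let U , U⊥n , U*g≈x = unit*gcd≈ x
        W , W⊥n , W*g≈y = unit*gcd≈ y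
        V , V*U≈1 = coprime⇒invertible U⊥n
        V′ , V′*W≈1 = coprime⇒invertible W⊥n
    in W * V , U * V′ , rescale-inverse U V W V′ V*U≈1 V′*W≈1
     , rescale U V W (gcd x n) V*U≈1 U*g≈x (subst (λ g → W * g ≈ y) (sym gcd≡) W*g≈y)

  sum-cong-≈ : ∀ {k} {f g : Fin k → ℕ} → (∀ i → f i ≈ g i) → sum f ≈ sum g
  sum-cong-≈ {zero}  f≈g = ≈-refl
  sum-cong-≈ {suc k} f≈g = +-cong (f≈g Fin.zero) (sum-cong-≈ (f≈g ∘ Fin.suc))

length-filterᵇ-map : ∀ {A B : Set} (P : B → Bool) (f : A → B) ys →
                     length (filterᵇ P (map f ys)) ≡ length (filterᵇ (P ∘ f) ys)
length-filterᵇ-map P f List.[] = refl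
length-filterᵇ-map P f (y List.∷ ys) with P (f y)
... | true  = cong suc (length-filterᵇ-map P f ys)
... | false = length-filterᵇ-map P f ys

filterᵇ-cong : ∀ {A : Set} {P Q : A → Bool} → (∀ x → P x ≡ Q x) → ∀ xs → filterᵇ P xs ≡ filterᵇ Q xs
filterᵇ-cong P≗Q = filter-≐ (T? ∘ _) (T? ∘ _) ((λ {x} → subst T (P≗Q x)) , (λ {x} → subst T (sym (P≗Q x))))

module _ {A : Set} {xs : List A} (xs-unique : Unique xs) (∈-xs : ∀ x → x ∈ xs) where

  map-↔-↭ : (f : A ↔ A) → map (Inverse.to f) xs ↭ xs
  map-↔-↭ f = ∼bag⇒↭ (unique∧set⇒bag (Unique.map⁺ to-injective xs-unique) xs-unique
    λ {x} → mk⇔ (λ _ → ∈-xs x) (λ _ → subst (_∈ _) (strictlyInverseˡ x) (∈-map⁺ to (∈-xs (from x)))))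
    where
    open Inverse f
    to-injective : ∀ {x y} → to x ≡ to y → x ≡ y
    to-injective {x} {y} eq = trans (sym (strictlyInverseʳ x)) (trans (cong from eq) (strictlyInverseʳ y))

  length-filterᵇ-↔ : (f : A ↔ A) (P : A → Bool) →
                     length (filterᵇ P xs) ≡ length (filterᵇ (P ∘ Inverse.to f) xs)
  length-filterᵇ-↔ f P = trans (sym (↭-length (filter-↭ (T? ∘ P) (map-↔-↭ f))))
                               (length-filterᵇ-map P (Inverse.to f) xs)

∈-allSubsets : ∀ {n} (S : Subset n) → S ∈ allSubsets n
∈-allSubsets []                  = here refl
∈-allSubsets (false ∷ S)         = ∈-++⁺ˡ (∈-map⁺ (false ∷_) (∈-allSubsets S))
∈-allSubsets {suc n} (true ∷ S)  = ∈-++⁺ʳ (map (false ∷_) (allSubsets n)) (∈-map⁺ (true ∷_) (∈-allSubsets S))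

allSubsets-unique : ∀ n → Unique (allSubsets n)
allSubsets-unique zero    = All.[] ∷ []
allSubsets-unique (suc n) = Unique.++⁺ (cons-unique false) (cons-unique true) disjoint
  where
  cons-unique : ∀ b → Unique (map (b ∷_) (allSubsets n))
  cons-unique b = Unique.map⁺ ∷-injectiveʳ (allSubsets-unique n)
  disjoint : ∀ {S} → S ∈ map (false ∷_) (allSubsets n) × S ∈ map (true ∷_) (allSubsets n) → ⊥
  disjoint (S∈₀ , S∈₁) with ∈-map⁻ (false ∷_) S∈₀ | ∈-map⁻ (true ∷_) S∈₁
  ... | _ , _ , refl | _ , _ , ()

-- For a permutation π, preimage (π ⟨$⟩ˡ_) S is the image of S under π.
preimage : ∀ {m n} → (Fin m → Fin n) → Subset n → Subset m
preimage f S = tabulate (lookup S ∘ f)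

lookup-preimage : ∀ {m n} (f : Fin m → Fin n) (S : Subset n) i → lookup (preimage f S) i ≡ lookup S (f i)
lookup-preimage f S = lookup∘tabulate (lookup S ∘ f)

preimage-cancel : ∀ {n} {f g : Fin n → Fin n} → (∀ i → f (g i) ≡ i) → ∀ S → preimage g (preimage f S) ≡ S
preimage-cancel {f = f} {g} f∘g≗id S = trans
  (tabulate-cong λ i → trans (lookup-preimage f S (g i)) (cong (lookup S) (f∘g≗id i)))
  (tabulate∘lookup S)

lookup-preimage-⟨$⟩ʳ : ∀ {n} (π : Permutation′ n) S i → lookup (preimage (π ⟨$⟩ˡ_) S) (π ⟨$⟩ʳ i) ≡ lookup S i
lookup-preimage-⟨$⟩ʳ π S i =
  trans (lookup-preimage (π ⟨$⟩ˡ_) S (π ⟨$⟩ʳ i)) (cong (lookup S) (Permutation.inverseˡ π))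

preimage-↔ : ∀ {n} → Permutation′ n → Subset n ↔ Subset n
preimage-↔ π = mk↔ₛ′ (preimage (π ⟨$⟩ˡ_)) (preimage (π ⟨$⟩ʳ_))
  (preimage-cancel λ _ → Permutation.inverseʳ π) (preimage-cancel λ _ → Permutation.inverseˡ π)

subsetSum : ∀ {n} → Subset n → (Fin n → ℕ) → ℕ
subsetSum S f = sum λ i → memVal (lookup S i) (f i)

subsetSum-preimage : ∀ {n} (π : Permutation′ n) S f →
                     subsetSum (preimage (π ⟨$⟩ˡ_) S) f ≡ subsetSum S (f ∘ (π ⟨$⟩ʳ_))
subsetSum-preimage π S f = begin
  subsetSum (preimage (π ⟨$⟩ˡ_) S) f                                            ≡⟨ sum-permute _ π ⟩
  sum (λ j → memVal (lookup (preimage (π ⟨$⟩ˡ_) S) (π ⟨$⟩ʳ j)) (f (π ⟨$⟩ʳ j)))  ≡⟨ sum-cong-≗ lookup-π ⟩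
  subsetSum S (f ∘ (π ⟨$⟩ʳ_))                                                   ∎
  where
  open ≡-Reasoning
  lookup-π : ∀ j → memVal (lookup (preimage (π ⟨$⟩ˡ_) S) (π ⟨$⟩ʳ j)) (f (π ⟨$⟩ʳ j))
                 ≡ memVal (lookup S j) (f (π ⟨$⟩ʳ j))
  lookup-π j = cong (λ b → memVal b (f (π ⟨$⟩ʳ j))) (lookup-preimage-⟨$⟩ʳ π S j)

subsetSum-*ˡ : ∀ {n} (S : Subset n) c f → subsetSum S (λ i → c * f i) ≡ c * subsetSum S f
subsetSum-*ˡ [] c f = sym (*-zeroʳ c)
subsetSum-*ˡ (b ∷ S) c f =
  trans (cong₂ _+_ (memVal-* b) (subsetSum-*ˡ S c (f ∘ Fin.suc))) (sym (*-distribˡ-+ c _ _))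
  where
  memVal-* : ∀ b → memVal b (c * f Fin.zero) ≡ c * memVal b (f Fin.zero)
  memVal-* true  = refl
  memVal-* false = sym (*-zeroʳ c)

∣∣≡subsetSum : ∀ {n} (S : Subset n) → ∣ S ∣ ≡ subsetSum S (λ _ → 1)
∣∣≡subsetSum []          = refl
∣∣≡subsetSum (true ∷ S)  = cong suc (∣∣≡subsetSum S)
∣∣≡subsetSum (false ∷ S) = ∣∣≡subsetSum S

elemSum≡subsetSum : ∀ {n} (S : Subset n) → elemSum S ≡ subsetSum S toℕ
elemSum≡subsetSum S = sum-tabulate (λ i → memVal (lookup S i) (toℕ i))
  where
  sum-tabulate : ∀ {k} (f : Fin k → ℕ) → Vec.sum (tabulate f) ≡ sum f
  sum-tabulate {zero}  f = refl
  sum-tabulate {suc k} f = cong (f Fin.zero +_) (sum-tabulate (f ∘ Fin.suc))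

sumsTo≡does-≈? : ∀ n .{{_ : NonZero n}} S x → sumsTo n S x ≡ does (Modulo._≈?_ n (elemSum S) (toℕ x))
sumsTo≡does-≈? (suc m) S x = cong (elemSum S % suc m ≡ᵇ_) (sym (m<n⇒m%n≡m (toℕ<n x)))

module Scaling (n : ℕ) .{{_ : NonZero n}} (u v : ℕ) (v*u≈1 : Modulo._≈_ n (v * u) 1) where
  open Modulo n

  u*v≈1 : u * v ≈ 1
  u*v≈1 = ≈-trans (≈-reflexive (*-comm u v)) v*u≈1

  scale : ℕ → Fin n → Fin n
  scale c g = fromℕ< (m%n<n (c * toℕ g) n)

  scale-≈ : ∀ c g → toℕ (scale c g) ≈ c * toℕ g
  scale-≈ c g = ≈-trans (≈-reflexive (toℕ-fromℕ< (m%n<n (c * toℕ g) n))) (m%n≈m (c * toℕ g))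

  scale-inverse : ∀ a b → b * a ≈ 1 → ∀ g → scale b (scale a g) ≡ g
  scale-inverse a b b*a≈1 g = toℕ-injective (≈-toℕ (begin
    toℕ (scale b (scale a g))   ≈⟨ scale-≈ b _ ⟩
    b * toℕ (scale a g)         ≈⟨ *-congˡ b (scale-≈ a g) ⟩
    b * (a * toℕ g)             ≈⟨ unit-cancelˡ a b (toℕ g) b*a≈1 ⟩
    toℕ g                       ∎))
    where
    open ≈-Reasoning ≈-setoid
    ≈-toℕ : ∀ {x y : Fin n} → toℕ x ≈ toℕ y → toℕ x ≡ toℕ y
    ≈-toℕ {x} {y} (mk≈ x≡y) = trans (sym (m<n⇒m%n≡m (toℕ<n x))) (trans x≡y (m<n⇒m%n≡m (toℕ<n y)))

  scaling : Permutation′ n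
  scaling = permutation (scale u) (scale v) (scale-inverse v u u*v≈1) (scale-inverse u v v*u≈1)

  scaled : Subset n → Subset n
  scaled = preimage (scaling ⟨$⟩ˡ_)

  ∣scaled∣ : ∀ S → ∣ scaled S ∣ ≡ ∣ S ∣
  ∣scaled∣ S = begin
    ∣ scaled S ∣                       ≡⟨ ∣∣≡subsetSum (scaled S) ⟩
    subsetSum (scaled S) (λ _ → 1)     ≡⟨ subsetSum-preimage scaling S _ ⟩
    subsetSum S (λ _ → 1)              ≡⟨ ∣∣≡subsetSum S ⟨
    ∣ S ∣                              ∎
    where open ≡-Reasoning

  elemSum-scaled : ∀ S → elemSum (scaled S) ≈ u * elemSum S
  elemSum-scaled S = begin
    elemSum (scaled S)                 ≡⟨ elemSum≡subsetSum (scaled S) ⟩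
    subsetSum (scaled S) toℕ           ≡⟨ subsetSum-preimage scaling S toℕ ⟩
    subsetSum S (toℕ ∘ scale u)        ≈⟨ sum-cong-≈ (λ i → memVal-≈ (lookup S i) (scale-≈ u i)) ⟩
    subsetSum S (λ i → u * toℕ i)      ≡⟨ subsetSum-*ˡ S u toℕ ⟩
    u * subsetSum S toℕ                ≡⟨ cong (u *_) (elemSum≡subsetSum S) ⟨
    u * elemSum S                      ∎
    where
    open ≈-Reasoning ≈-setoid
    memVal-≈ : ∀ b {a c} → a ≈ c → memVal b a ≈ memVal b c
    memVal-≈ true  a≈c = a≈c
    memVal-≈ false _   = ≈-refl

  module _ {x y : Fin n} (u*x≈y : u * toℕ x ≈ toℕ y) where

    scaled≈y⇔≈x : ∀ S → elemSum (scaled S) ≈ toℕ y ⇔ elemSum S ≈ toℕ x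
    scaled≈y⇔≈x S = mk⇔
      (λ eq → unit-*-injective u v v*u≈1 (≈-trans (≈-sym (elemSum-scaled S)) (≈-trans eq (≈-sym u*x≈y))))
      (λ eq → ≈-trans (elemSum-scaled S) (≈-trans (*-congˡ u eq) u*x≈y))

    inB-scaled : ∀ k S → inB n k y (scaled S) ≡ inB n k x S
    inB-scaled k S = cong₂ _∧_ (cong (_≡ᵇ k) (∣scaled∣ S)) (begin
      sumsTo n (scaled S) y                ≡⟨ sumsTo≡does-≈? n (scaled S) y ⟩
      does (elemSum (scaled S) ≈? toℕ y)   ≡⟨ does-⇔ (scaled≈y⇔≈x S) (elemSum (scaled S) ≈? toℕ y)
                                                                    (elemSum S ≈? toℕ x) ⟩
      does (elemSum S ≈? toℕ x)            ≡⟨ sumsTo≡does-≈? n S x ⟨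
      sumsTo n S x                         ∎)
      where open ≡-Reasoning

    replication-scaling : ∀ k g → replication n k y (scaling ⟨$⟩ʳ g) ≡ replication n k x g
    replication-scaling k g = trans
      (length-filterᵇ-↔ (allSubsets-unique n) ∈-allSubsets (preimage-↔ scaling) _)
      (cong length (filterᵇ-cong blocks-through-g (allSubsets n)))
      where
      blocks-through-g : ∀ S → (inB n k y (scaled S) ∧ lookup (scaled S) (scaling ⟨$⟩ʳ g))
                             ≡ (inB n k x S ∧ lookup S g)
      blocks-through-g S = cong₂ _∧_ (inB-scaled k S) (lookup-preimage-⟨$⟩ʳ scaling S g)

Is1Design-transport : ∀ {n k x y} (π : Permutation′ n) →
  (∀ g → replication n k y (π ⟨$⟩ʳ g) ≡ replication n k x g) → Is1Design n k x → Is1Design n k y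
Is1Design-transport {n} {k} {x} {y} π rep-π design g h = begin
  replication n k y g                     ≡⟨ cong (replication n k y) (Permutation.inverseʳ π) ⟨
  replication n k y (π ⟨$⟩ʳ (π ⟨$⟩ˡ g))   ≡⟨ rep-π (π ⟨$⟩ˡ g) ⟩
  replication n k x (π ⟨$⟩ˡ g)            ≡⟨ design _ _ ⟩
  replication n k x (π ⟨$⟩ˡ h)            ≡⟨ rep-π (π ⟨$⟩ˡ h) ⟨
  replication n k y (π ⟨$⟩ʳ (π ⟨$⟩ˡ h))   ≡⟨ cong (replication n k y) (Permutation.inverseʳ π) ⟩
  replication n k y h                     ∎
  where open ≡-Reasoning

Is1Design-unit-multiple : ∀ n .{{_ : NonZero n}} k u v {x y : Fin n} → let open Modulo n in
  v * u ≈ 1 → u * toℕ x ≈ toℕ y → Is1Design n k x → Is1Design n k y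
Is1Design-unit-multiple n k u v v*u≈1 u*x≈y = Is1Design-transport scaling (replication-scaling u*x≈y k)
  where open Scaling n u v v*u≈1

theorem5 : (n k : ℕ) → 2 ≤ k → k ≤ n ∸ 1 → (x₁ x₂ : Fin n) →
    gcd (toℕ x₁) n ≡ gcd (toℕ x₂) n →
    Is1Design n k x₁ ⇔ Is1Design n k x₂
theorem5 zero    k _ _ () x₂ gcd≡
theorem5 n@(suc _) k _ _ x₁ x₂ gcd≡ = mk⇔ (transfer gcd≡) (transfer (sym gcd≡))
  where
  transfer : ∀ {x y : Fin n} → gcd (toℕ x) n ≡ gcd (toℕ y) n → Is1Design n k x → Is1Design n k y
  transfer gcd≡ = let u , v , v*u≈1 , u*x≈y = Modulo.gcd≡⇒unit-multiple n gcd≡ in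
    Is1Design-unit-multiple n k u v v*u≈1 u*x≈y
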